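{- Let $q$ be a prime power. There exists a semi-resolving set of size $4q$ for the points of $W(q)$.
   Context: A null polarity $\pi$ of $\mathrm{PG}(3,q)$ is a polarity (an incidence-reversing involutory correspondence between points and planes, inducing an involution on lines) such that every point $P$ lies in its image plane $P^\pi$; a line $\ell$ is self-conjugate if $\ell^\pi=\ell$. $W(q)$ is the generalized quadrangle whose points are all points of $\mathrm{PG}(3,q)$ and whose lines are the self-conjugate lines of a null polarity, with inherited incidence. A semi-resolving set for the points is a set $S$ of vertices of the incidence graph (bipartite graph on points and lines, adjacency = incidence) such that any two distinct points $P\neq P'$ have some $x\in S$ with $d(P,x)\neq d(P',x)$, where $d$ is graph distance. -}

module Defs where

open import Level using (Level; _⊔_) renaming (suc to lsuc)
open import Algebra.Bundles using (CommutativeRing)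
open import Data.Nat using (ℕ; suc; _<_)
open import Data.Fin using (Fin) renaming (zero to fz; suc to fs)
open import Data.List using (List; length)
open import Data.List.Relation.Unary.Any using (Any)
open import Data.List.Relation.Unary.AllPairs using (AllPairs)
open import Data.List.Membership.Propositional using (_∈_)
open import Data.Product using (Σ; ∃; ∃₂; _×_; _,_)
open import Data.Sum using (_⊎_; inj₁; inj₂)
open import Relation.Nullary using (¬_)
open import Data.Empty.Polymorphic using () renaming (⊥ to Lift⊥)
open import Relation.Binary using (Decidable)
open import Relation.Binary.PropositionalEquality using (_≡_; _≢_)

record FiniteField (c ℓ : Level) : Set (lsuc (c ⊔ ℓ)) where
  field
    commRing : CommutativeRing c ℓ
  open CommutativeRing commRing public
  field
    0≉1      : ¬ (0# ≈ 1#)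
    inverse  : ∀ x → ¬ (x ≈ 0#) → ∃ λ y → (x * y) ≈ 1#
    _≟_      : Decidable _≈_
    q        : ℕ
    elements : List Carrier
    length-elements : length elements ≡ q
    complete : ∀ x → Any (x ≈_) elements
    distinct : AllPairs (λ x y → ¬ (x ≈ y)) elements

-- The generalized quadrangle W(q) over a finite field F, built from the
-- null polarity of PG(3,F) associated with the standard symplectic form
--   β(x,y) = x₀y₁ − x₁y₀ + x₂y₃ − x₃y₂ .
module W {c ℓ : Level} (F : FiniteField c ℓ) where
  open FiniteField F using (Carrier; _≈_; _+_; _*_; _-_; 0#; 1#)

  Vec4 : Set c
  Vec4 = Fin 4 → Carrier

  c0 c1 c2 c3 : Fin 4
  c0 = fz
  c1 = fs fz
  c2 = fs (fs fz)
  c3 = fs (fs (fs fz))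

  β : Vec4 → Vec4 → Carrier
  β x y = ((x c0 * y c1) - (x c1 * y c0)) + ((x c2 * y c3) - (x c3 * y c2))

  NonZero : Vec4 → Set ℓ
  NonZero v = ¬ (∀ i → v i ≈ 0#)

  -- points of PG(3,q): nonzero vectors, up to proportionality
  Point : Set (c ⊔ ℓ)
  Point = Σ Vec4 NonZero

  vec : Point → Vec4
  vec (v , _) = v

  _∼_ : Point → Point → Set (c ⊔ ℓ)
  P ∼ P' = ∃ λ a → ∀ i → vec P i ≈ (a * vec P' i)

  InSpan : Vec4 → Vec4 → Vec4 → Set (c ⊔ ℓ)
  InSpan v u w = ∃₂ λ a b → ∀ i → v i ≈ ((a * u i) + (b * w i))

  -- lines of W(q): self-conjugate (totally isotropic) lines of PG(3,q),
  -- given by two distinct points spanning them with β(A,B) = 0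
  record Line : Set (c ⊔ ℓ) where
    constructor line
    field
      A : Point
      B : Point
      A≁B : ¬ (A ∼ B)
      isotropic : β (vec A) (vec B) ≈ 0#
  open Line public

  Incident : Point → Line → Set (c ⊔ ℓ)
  Incident P L = InSpan (vec P) (vec (A L)) (vec (B L))

  _≋_ : Line → Line → Set (c ⊔ ℓ)
  L ≋ L' = Incident (A L') L × Incident (B L') L

  Vertex : Set (c ⊔ ℓ)
  Vertex = Point ⊎ Line

  _≈V_ : Vertex → Vertex → Set (c ⊔ ℓ)
  inj₁ P ≈V inj₁ P' = P ∼ P'
  inj₂ L ≈V inj₂ L' = L ≋ L'
  inj₁ _ ≈V inj₂ _ = Lift⊥
  inj₂ _ ≈V inj₁ _ = Lift⊥

  Adj : Vertex → Vertex → Set (c ⊔ ℓ)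
  Adj (inj₁ P) (inj₂ L) = Incident P L
  Adj (inj₂ L) (inj₁ P) = Incident P L
  Adj (inj₁ _) (inj₁ _) = Lift⊥
  Adj (inj₂ _) (inj₂ _) = Lift⊥

  data Walk : Vertex → Vertex → ℕ → Set (c ⊔ ℓ) where
    here : ∀ {x y} → x ≈V y → Walk x y 0
    step : ∀ {x y z n} → Adj x y → Walk y z n → Walk x z (suc n)

  Dist : Vertex → Vertex → ℕ → Set (c ⊔ ℓ)
  Dist x y n = Walk x y n × (∀ m → m < n → ¬ Walk x y m)

  SemiResolving : List Vertex → Set (c ⊔ ℓ)
  SemiResolving S = ∀ (P P' : Point) → ¬ (P ∼ P') →
    ∃ λ x → x ∈ S × ∃₂ λ m n → Dist (inj₁ P) x m × Dist (inj₁ P') x n × m ≢ n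

  DistinctVertices : List Vertex → Set (c ⊔ ℓ)
  DistinctVertices S = AllPairs (λ x y → ¬ (x ≈V y)) S

module Submission where

-- S consists of the points X₁(t) = (1,0,0,t), X₂(t) = (0,−1,−t,0), X₃(t) = (1,−t,1,t) and the
-- lines T(s) = ⟨(1,0,s,0), (0,−s,0,1)⟩ for t, s ∈ F. A point X is at distance 0 or 2 from P when
-- β(P,X) = 0 and at distance 4 otherwise; a line is at distance 1 or 3 from P according as P lies
-- on it or not. For each family, β(u, Xₖ(t)) = t·gₖ(u) − fₖ(u) is affine in t, so if no Xₖ(t)
-- separates P and P′ these affine maps have the same roots and (fₖ, gₖ)(P′) is a multiple of
-- (fₖ, gₖ)(P). The first two families give P′ = (l₂p₀, l₁p₁, l₁p₂, l₂p₃), the third gives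
-- μp₁ = νp₃ and μp₂ = −νp₀ with μ = l₁ − l₃, ν = l₃ − l₂. Unless P′ is then already a multiple
-- of P (as when l₁ = l₂, μ = 0 or ν = 0), P lies on T(−ν/μ) and P′ cannot, so that line separates.

open import Defs
open import Level using (Level)
open import Data.Nat using (_*_)
open import Data.List using (List; length)
open import Data.Product using (∃; _×_)
open import Relation.Binary.PropositionalEquality using (_≡_)

open import Level using (_⊔_; 0ℓ)
open import Algebra.Bundles using (CommutativeRing; RawRing)
open import Algebra.Solver.Ring.AlmostCommutativeRing
  using (fromCommutativeRing; _-Raw-AlmostCommutative⟶_)
open import Data.Nat as ℕ using (ℕ; zero; suc; parity; _<_; s≤s)
import Data.Nat.Properties as ℕP
open import Data.Parity.Base as ℙ using (Parity; 0ℙ; 1ℙ)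
import Data.Parity.Properties as ℙP
open import Data.Fin using (Fin) renaming (zero to fz; suc to fs)
open import Data.Fin.Properties using (all?)
open import Data.Vec.Functional using ([]; _∷_)
open import Data.Product using (Σ; ∃₂; _,_; proj₁; proj₂)
open import Data.Product.Properties using (≡-dec)
open import Data.Sum using (_⊎_; inj₁; inj₂; fromInj₁)
import Data.Sum.Effectful.Left as SumMonad
open import Effect.Monad using (RawMonad)
open import Data.Maybe using (Maybe; just; nothing)
open import Data.List using (map; _++_)
open import Data.List.Properties using (length-++; length-map)
open import Data.List.Relation.Unary.Any using (any?)
open import Data.List.Relation.Unary.All using (All)
import Data.List.Relation.Unary.All as All
import Data.List.Relation.Unary.All.Properties as All
import Data.List.Relation.Unary.AllPairs as AllPairs
import Data.List.Relation.Unary.AllPairs.Properties as AllPairs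
open import Data.List.Membership.Propositional using (_∈_; find; lose)
open import Data.List.Membership.Propositional.Properties using (∈-map⁺; ∈-++⁺ˡ; ∈-++⁺ʳ)
open import Relation.Nullary using (¬_; ¬?; Dec; yes; no; _×-dec_; contradiction)
open import Relation.Nullary.Decidable using (decidable-stable)
open import Relation.Unary using (Pred)
import Relation.Unary as U
open import Relation.Binary using (_Respects_)
import Relation.Binary.PropositionalEquality as ≡
open import Relation.Binary.PropositionalEquality using (_≢_)

module CommutativeRingSolver {c ℓ} (R : CommutativeRing c ℓ) where
  open CommutativeRing R renaming (_*_ to _·_) hiding (zero)
  open import Algebra.Properties.Ring ring
    using (-0#≈0#; -‿+-comm; -‿involutive; -‿distribˡ-*; -‿distribʳ-*)
  open import Algebra.Properties.Semiring.Mult.TCOptimised semiring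
    using (1+×; ×-homo-+; ×1-homo-*) renaming (_×_ to _·ℕ_)
  open import Algebra.Properties.CommutativeSemigroup +-commutativeSemigroup
    using (interchange)
  open import Relation.Binary.Reasoning.Setoid setoid

  -- Integer coefficients: (a , b) stands for a − b, normalised to have a zero entry, so that
  -- equal integers are represented identically and the solver can compare them syntactically.
  Diff : Set
  Diff = ℕ × ℕ

  normalise : ℕ → ℕ → Diff
  normalise (suc a) (suc b) = normalise a b
  normalise a       b       = a , b

  ι : ℕ → Carrier
  ι n = n ·ℕ 1#

  -- The case b = 0 makes the constants (0 , 0) and (1 , 0) denote 0# and 1# definitionally.
  ⟦_⟧ : Diff → Carrier
  ⟦ a , zero  ⟧ = ι a
  ⟦ a , suc b ⟧ = ι a - ι (suc b)

  ⟦⟧≈difference : ∀ a b → ⟦ a , b ⟧ ≈ ι a - ι b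
  ⟦⟧≈difference a zero    = sym (trans (+-congˡ -0#≈0#) (+-identityʳ (ι a)))
  ⟦⟧≈difference a (suc b) = refl

  [x+y]-[x+z]≈y-z : ∀ x y z → (x + y) - (x + z) ≈ y - z
  [x+y]-[x+z]≈y-z x y z = begin
    (x + y) + - (x + z)     ≈⟨ +-congˡ (-‿+-comm x z) ⟨
    (x + y) + (- x + - z)   ≈⟨ interchange x y (- x) (- z) ⟩
    (x + - x) + (y + - z)   ≈⟨ +-congʳ (-‿inverseʳ x) ⟩
    0# + (y - z)            ≈⟨ +-identityˡ _ ⟩
    y - z                   ∎

  normalise-correct : ∀ a b → ⟦ normalise a b ⟧ ≈ ι a - ι b
  normalise-correct (suc a) (suc b) = begin
    ⟦ normalise a b ⟧             ≈⟨ normalise-correct a b ⟩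
    ι a - ι b                     ≈⟨ [x+y]-[x+z]≈y-z 1# (ι a) (ι b) ⟨
    (1# + ι a) - (1# + ι b)       ≈⟨ +-cong (1+× a 1#) (-‿cong (1+× b 1#)) ⟨
    ι (suc a) - ι (suc b)         ∎
  normalise-correct zero    b       = ⟦⟧≈difference zero b
  normalise-correct (suc a) zero    = ⟦⟧≈difference (suc a) zero

  _+ᴰ_ : Diff → Diff → Diff
  (a , b) +ᴰ (a′ , b′) = normalise (a ℕ.+ a′) (b ℕ.+ b′)

  _*ᴰ_ : Diff → Diff → Diff
  (a , b) *ᴰ (a′ , b′) = normalise (a ℕ.* a′ ℕ.+ b ℕ.* b′) (a ℕ.* b′ ℕ.+ b ℕ.* a′)

  -ᴰ_ : Diff → Diff
  -ᴰ (a , b) = b , a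

  Coefficients : RawRing 0ℓ 0ℓ
  Coefficients = record
    { Carrier = Diff ; _≈_ = _≡_ ; _+_ = _+ᴰ_ ; _*_ = _*ᴰ_ ; -_ = -ᴰ_
    ; 0# = 0 , 0 ; 1# = 1 , 0 }

  ι-homo-+ : ∀ m n → ι (m ℕ.+ n) ≈ ι m + ι n
  ι-homo-+ = ×-homo-+ 1#

  -x·-y≈x·y : ∀ x y → - x · - y ≈ x · y
  -x·-y≈x·y x y = begin
    - x · - y        ≈⟨ -‿distribˡ-* x (- y) ⟨
    - (x · - y)      ≈⟨ -‿cong (-‿distribʳ-* x y) ⟨
    - - (x · y)      ≈⟨ -‿involutive (x · y) ⟩
    x · y            ∎

  [x-y][z-w]≈[xz+yw]-[xw+yz] : ∀ x y z w → (x - y) · (z - w) ≈ (x · z + y · w) - (x · w + y · z)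
  [x-y][z-w]≈[xz+yw]-[xw+yz] x y z w = begin
    (x + - y) · (z + - w)                         ≈⟨ distribʳ (z + - w) x (- y) ⟩
    x · (z + - w) + - y · (z + - w)               ≈⟨ +-cong (distribˡ x z (- w)) (distribˡ (- y) z (- w)) ⟩
    (x · z + x · - w) + (- y · z + - y · - w)
      ≈⟨ +-cong (+-congˡ (-‿distribʳ-* x w)) (+-cong (-‿distribˡ-* y z) (sym (-x·-y≈x·y y w))) ⟨
    (x · z + - (x · w)) + (- (y · z) + y · w)     ≈⟨ +-congˡ (+-comm _ _) ⟩
    (x · z + - (x · w)) + (y · w + - (y · z))     ≈⟨ interchange _ _ _ _ ⟩
    (x · z + y · w) + (- (x · w) + - (y · z))     ≈⟨ +-congˡ (-‿+-comm _ _) ⟩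
    (x · z + y · w) - (x · w + y · z)             ∎

  +ᴰ-homo : ∀ x y → ⟦ x +ᴰ y ⟧ ≈ ⟦ x ⟧ + ⟦ y ⟧
  +ᴰ-homo (a , b) (a′ , b′) = begin
    ⟦ normalise (a ℕ.+ a′) (b ℕ.+ b′) ⟧     ≈⟨ normalise-correct (a ℕ.+ a′) (b ℕ.+ b′) ⟩
    ι (a ℕ.+ a′) - ι (b ℕ.+ b′)             ≈⟨ +-cong (ι-homo-+ a a′) (-‿cong (ι-homo-+ b b′)) ⟩
    (ι a + ι a′) + - (ι b + ι b′)           ≈⟨ +-congˡ (-‿+-comm (ι b) (ι b′)) ⟨
    (ι a + ι a′) + (- ι b + - ι b′)         ≈⟨ interchange (ι a) (ι a′) (- ι b) (- ι b′) ⟩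
    (ι a - ι b) + (ι a′ - ι b′)             ≈⟨ +-cong (⟦⟧≈difference a b) (⟦⟧≈difference a′ b′) ⟨
    ⟦ a , b ⟧ + ⟦ a′ , b′ ⟧                 ∎

  *ᴰ-homo : ∀ x y → ⟦ x *ᴰ y ⟧ ≈ ⟦ x ⟧ · ⟦ y ⟧
  *ᴰ-homo (a , b) (a′ , b′) = begin
    ⟦ normalise (a ℕ.* a′ ℕ.+ b ℕ.* b′) (a ℕ.* b′ ℕ.+ b ℕ.* a′) ⟧
      ≈⟨ normalise-correct (a ℕ.* a′ ℕ.+ b ℕ.* b′) (a ℕ.* b′ ℕ.+ b ℕ.* a′) ⟩
    ι (a ℕ.* a′ ℕ.+ b ℕ.* b′) - ι (a ℕ.* b′ ℕ.+ b ℕ.* a′)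
      ≈⟨ +-cong (ι-homo-*+* a a′ b b′) (-‿cong (ι-homo-*+* a b′ b a′)) ⟩
    (ι a · ι a′ + ι b · ι b′) - (ι a · ι b′ + ι b · ι a′)
      ≈⟨ [x-y][z-w]≈[xz+yw]-[xw+yz] (ι a) (ι b) (ι a′) (ι b′) ⟨
    (ι a - ι b) · (ι a′ - ι b′)
      ≈⟨ *-cong (⟦⟧≈difference a b) (⟦⟧≈difference a′ b′) ⟨
    ⟦ a , b ⟧ · ⟦ a′ , b′ ⟧ ∎
    where
    ι-homo-*+* : ∀ k l m n → ι (k ℕ.* l ℕ.+ m ℕ.* n) ≈ ι k · ι l + ι m · ι n
    ι-homo-*+* k l m n = trans (ι-homo-+ (k ℕ.* l) (m ℕ.* n)) (+-cong (×1-homo-* k l) (×1-homo-* m n))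

  -ᴰ-homo : ∀ x → ⟦ -ᴰ x ⟧ ≈ - ⟦ x ⟧
  -ᴰ-homo (a , b) = begin
    ⟦ b , a ⟧            ≈⟨ ⟦⟧≈difference b a ⟩
    ι b + - ι a          ≈⟨ +-comm _ _ ⟩
    - ι a + ι b          ≈⟨ +-congˡ (-‿involutive (ι b)) ⟨
    - ι a + - - ι b      ≈⟨ -‿+-comm (ι a) (- ι b) ⟩
    - (ι a - ι b)        ≈⟨ -‿cong (⟦⟧≈difference a b) ⟨
    - ⟦ a , b ⟧          ∎

  homomorphism : Coefficients -Raw-AlmostCommutative⟶ fromCommutativeRing R
  homomorphism = record
    { ⟦_⟧ = ⟦_⟧ ; +-homo = +ᴰ-homo ; *-homo = *ᴰ-homo ; -‿homo = -ᴰ-homo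
    ; 0-homo = refl ; 1-homo = refl }

  _≟ᴰ_ : ∀ x y → Maybe (⟦ x ⟧ ≈ ⟦ y ⟧)
  x ≟ᴰ y with ≡-dec ℕP._≟_ ℕP._≟_ x y
  ... | yes ≡.refl = just refl
  ... | no _       = nothing

  open import Algebra.Solver.Ring Coefficients (fromCommutativeRing R) homomorphism _≟ᴰ_
    public using (Polynomial; solve; _:=_; _:+_; _:*_; _:-_; :-_; con)

length-++-map₄ : ∀ {a b} {A : Set a} {B : Set b} (f g h k : A → B) (xs : List A) →
  length (map f xs ++ map g xs ++ map h xs ++ map k xs) ≡ 4 * length xs
length-++-map₄ f g h k xs = begin
  length (map f xs ++ map g xs ++ map h xs ++ map k xs)
    ≡⟨ length-++ (map f xs) ⟩
  length (map f xs) ℕ.+ length (map g xs ++ map h xs ++ map k xs)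
    ≡⟨ ≡.cong (length (map f xs) ℕ.+_) (length-++ (map g xs)) ⟩
  length (map f xs) ℕ.+ (length (map g xs) ℕ.+ length (map h xs ++ map k xs))
    ≡⟨ ≡.cong (λ m → length (map f xs) ℕ.+ (length (map g xs) ℕ.+ m)) (length-++ (map h xs)) ⟩
  length (map f xs) ℕ.+ (length (map g xs) ℕ.+ (length (map h xs) ℕ.+ length (map k xs)))
    ≡⟨ ≡.cong₂ ℕ._+_ (length-map f xs) (≡.cong₂ ℕ._+_ (length-map g xs)
         (≡.cong₂ ℕ._+_ (length-map h xs) (≡.trans (length-map k xs) (≡.sym (ℕP.+-identityʳ _))))) ⟩
  4 * length xs ∎
  where open ≡.≡-Reasoning

module IncidenceParity {c ℓ : Level} (F : FiniteField c ℓ) where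
  open W F
  open ≡.≡-Reasoning

  side : Vertex → Parity
  side (inj₁ _) = 0ℙ
  side (inj₂ _) = 1ℙ

  adj-side : ∀ {x y} → Adj x y → side y ≡ 1ℙ ℙ.+ side x
  adj-side {inj₁ _} {inj₂ _} _ = ≡.refl
  adj-side {inj₂ _} {inj₁ _} _ = ≡.refl

  ≈V-side : ∀ {x y} → x ≈V y → side x ≡ side y
  ≈V-side {inj₁ _} {inj₁ _} _ = ≡.refl
  ≈V-side {inj₂ _} {inj₂ _} _ = ≡.refl

  walk-parity : ∀ {x y n} → Walk x y n → side y ≡ parity n ℙ.+ side x
  walk-parity (here x≈y) = ≡.sym (≈V-side x≈y)
  walk-parity {x} {n = suc n} (step {y = z} x~z w) = begin
    side _                          ≡⟨ walk-parity w ⟩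
    parity n ℙ.+ side z             ≡⟨ ≡.cong (parity n ℙ.+_) (adj-side x~z) ⟩
    parity n ℙ.+ (1ℙ ℙ.+ side x)    ≡⟨ ℙP.+-assoc (parity n) 1ℙ (side x) ⟨
    (parity n ℙ.+ 1ℙ) ℙ.+ side x    ≡⟨ ≡.cong (ℙ._+ side x) (ℙP.+-comm (parity n) 1ℙ) ⟩
    (1ℙ ℙ.+ parity n) ℙ.+ side x    ≡⟨ ≡.cong (ℙ._+ side x) (ℙP.+-homo-+ 1 n) ⟨
    parity (suc n) ℙ.+ side x       ∎

module FiniteFieldProperties {c ℓ : Level} (F : FiniteField c ℓ) where
  open FiniteField F renaming (_*_ to _·_)
  open import Algebra.Properties.Ring ring
    using (-‿involutive; -0#≈0#; x∙y⁻¹≈ε⇒x≈y; x≈y⇒x∙y⁻¹≈ε)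
  open CommutativeRingSolver commRing using (solve; _:=_; _:*_; _:-_)
  open import Relation.Binary.Reasoning.Setoid setoid

  1#≉0# : 1# ≉ 0#
  1#≉0# 1≈0 = 0≉1 (sym 1≈0)

  inv : (x : Carrier) → x ≉ 0# → Carrier
  inv x x≉0 = proj₁ (inverse x x≉0)

  x·inv≈1 : ∀ x (x≉0 : x ≉ 0#) → x · inv x x≉0 ≈ 1#
  x·inv≈1 x x≉0 = proj₂ (inverse x x≉0)

  inv·x≈1 : ∀ x (x≉0 : x ≉ 0#) → inv x x≉0 · x ≈ 1#
  inv·x≈1 x x≉0 = trans (*-comm _ _) (x·inv≈1 x x≉0)

  x·y≈0⇒y≈0 : ∀ {x y} → x · y ≈ 0# → x ≉ 0# → y ≈ 0#
  x·y≈0⇒y≈0 {x} {y} xy≈0 x≉0 = begin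
    y                        ≈⟨ *-identityˡ y ⟨
    1# · y                   ≈⟨ *-congʳ (inv·x≈1 x x≉0) ⟨
    (inv x x≉0 · x) · y      ≈⟨ *-assoc _ x y ⟩
    inv x x≉0 · (x · y)      ≈⟨ *-congˡ xy≈0 ⟩
    inv x x≉0 · 0#           ≈⟨ zeroʳ _ ⟩
    0#                       ∎

  -x≈0⇒x≈0 : ∀ {x} → - x ≈ 0# → x ≈ 0#
  -x≈0⇒x≈0 {x} -x≈0 = trans (sym (-‿involutive x)) (trans (-‿cong -x≈0) -0#≈0#)

  x-y≈0⇒x≈y : ∀ {x y} → x - y ≈ 0# → x ≈ y
  x-y≈0⇒x≈y = x∙y⁻¹≈ε⇒x≈y _ _

  x≈y·z⇒inv·x≈z : ∀ {x y z} (y≉0 : y ≉ 0#) → x ≈ y · z → inv y y≉0 · x ≈ z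
  x≈y·z⇒inv·x≈z {x} {y} {z} y≉0 x≈yz = begin
    inv y y≉0 · x           ≈⟨ *-congˡ x≈yz ⟩
    inv y y≉0 · (y · z)     ≈⟨ *-assoc _ y z ⟨
    (inv y y≉0 · y) · z     ≈⟨ *-congʳ (inv·x≈1 y y≉0) ⟩
    1# · z                  ≈⟨ *-identityˡ z ⟩
    z                       ∎

  x·z≈y·z⇒z≈0 : ∀ {x y z} → x · z ≈ y · z → x ≉ y → z ≈ 0#
  x·z≈y·z⇒z≈0 {x} {y} {z} xz≈yz x≉y = x·y≈0⇒y≈0 (begin
    (x - y) · z         ≈⟨ solve 3 (λ x y z → (x :- y) :* z := x :* z :- y :* z) refl x y z ⟩
    x · z - y · z       ≈⟨ x≈y⇒x∙y⁻¹≈ε xz≈yz ⟩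
    0#                  ∎) (λ x-y≈0 → x≉y (x-y≈0⇒x≈y x-y≈0))

  ∃? : ∀ {p} {Q : Pred Carrier p} → U.Decidable Q → Q Respects _≈_ → Dec (∃ Q)
  ∃? Q? resp with any? Q? elements
  ... | yes any = let t , _ , Qt = find any in yes (t , Qt)
  ... | no ¬any = no λ (t , Qt) →
    let e , e∈ , t≈e = find (complete t) in ¬any (lose e∈ (resp t≈e Qt))

  ⊆-or-counterexample : ∀ {p r} {Q : Pred Carrier p} {R : Pred Carrier r} →
    U.Decidable Q → U.Decidable R → Q Respects _≈_ → R Respects _≈_ →
    (∀ t → Q t → R t) ⊎ ∃ λ t → t ∈ elements × Q t × ¬ R t
  ⊆-or-counterexample Q? R? Q-resp R-resp
    with any? (λ t → Q? t ×-dec ¬? (R? t)) elements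
  ... | yes any = inj₂ (let t , t∈ , Qt , ¬Rt = find any in t , t∈ , Qt , ¬Rt)
  ... | no ¬any = inj₁ λ t Qt → decidable-stable (R? t) λ ¬Rt →
    let e , e∈ , t≈e = find (complete t)
    in ¬any (lose e∈ (Q-resp t≈e Qt , λ Re → ¬Rt (R-resp (sym t≈e) Re)))

  All-map-elements : ∀ {b p} {B : Set b} {P : Pred B p} (f : Carrier → B) →
                     (∀ t → P (f t)) → All P (map f elements)
  All-map-elements f Pf = All.map⁺ (All.universal Pf elements)

  Root : Carrier → Carrier → Carrier → Set ℓ
  Root f g t = f ≈ t · g

  Multiple : Carrier → Carrier → Carrier → Carrier → Set (c ⊔ ℓ)
  Multiple f g f′ g′ = ∃ λ l → f′ ≈ l · f × g′ ≈ l · g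

  root? : ∀ f g → U.Decidable (Root f g)
  root? f g t = f ≟ (t · g)

  root-resp : ∀ f g → Root f g Respects _≈_
  root-resp f g s≈t f≈sg = trans f≈sg (*-congʳ s≈t)

  root-0⇒≈0 : ∀ {f g} → Root f g 0# → f ≈ 0#
  root-0⇒≈0 f≈0g = trans f≈0g (zeroˡ _)

  ≈0⇒root-0 : ∀ {f g} → f ≈ 0# → Root f g 0#
  ≈0⇒root-0 f≈0 = trans f≈0 (sym (zeroˡ _))

  x·inv-y·y≈x : ∀ x y (y≉0 : y ≉ 0#) → x · inv y y≉0 · y ≈ x
  x·inv-y·y≈x x y y≉0 = begin
    x · inv y y≉0 · y       ≈⟨ *-assoc x _ y ⟩
    x · (inv y y≉0 · y)     ≈⟨ *-congˡ (inv·x≈1 y y≉0) ⟩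
    x · 1#                  ≈⟨ *-identityʳ x ⟩
    x                       ∎

  root-quotient : ∀ f g (g≉0 : g ≉ 0#) → Root f g (f · inv g g≉0)
  root-quotient f g g≉0 = sym (x·inv-y·y≈x f g g≉0)

  two-roots⇒slope≈0 : ∀ {f g s t} → Root f g s → Root f g t → s ≉ t → g ≈ 0#
  two-roots⇒slope≈0 f≈sg f≈tg = x·z≈y·z⇒z≈0 (trans (sym f≈sg) f≈tg)

  x≉x+1 : ∀ x → x ≉ x + 1#
  x≉x+1 x x≈x+1 = 1#≉0# (begin
    1#                ≈⟨ +-identityˡ 1# ⟨
    0# + 1#           ≈⟨ +-congʳ (-‿inverseˡ x) ⟨
    (- x + x) + 1#    ≈⟨ +-assoc (- x) x 1# ⟩
    - x + (x + 1#)    ≈⟨ +-congˡ x≈x+1 ⟨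
    - x + x           ≈⟨ -‿inverseˡ x ⟩
    0#                ∎)

  slope≉0-transfer : ∀ {f g f′ g′} → g ≉ 0# →
    (∀ t → Root f g t → Root f′ g′ t) → (∀ t → Root f′ g′ t → Root f g t) → g′ ≉ 0#
  slope≉0-transfer {f} {g} {f′} {g′} g≉0 ⊆ ⊇ g′≈0 =
    g≉0 (two-roots⇒slope≈0 (root-quotient f g g≉0) root₁ (x≉x+1 t₀))
    where
    t₀ : Carrier
    t₀ = f · inv g g≉0
    f′≈0 : f′ ≈ 0#
    f′≈0 = trans (⊆ t₀ (root-quotient f g g≉0)) (trans (*-congˡ g′≈0) (zeroʳ t₀))
    root₁ : Root f g (t₀ + 1#)
    root₁ = ⊇ (t₀ + 1#) (trans f′≈0 (sym (trans (*-congˡ g′≈0) (zeroʳ _))))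

  sameRoots⇒multiple : ∀ {f g f′ g′} →
    (∀ t → Root f g t → Root f′ g′ t) → (∀ t → Root f′ g′ t → Root f g t) → Multiple f g f′ g′
  sameRoots⇒multiple {f} {g} {f′} {g′} ⊆ ⊇ with g ≟ 0# | g′ ≟ 0#
  ... | no g≉0 | no g′≉0 = g′ · inv g g≉0 , f′≈ , sym (x·inv-y·y≈x g′ g g≉0)
    where
    f′≈ : f′ ≈ g′ · inv g g≉0 · f
    f′≈ = trans (⊆ _ (root-quotient f g g≉0))
            (solve 3 (λ f i g′ → f :* i :* g′ := g′ :* i :* f) refl f (inv g g≉0) g′)
  ... | no g≉0 | yes g′≈0 = contradiction g′≈0 (slope≉0-transfer g≉0 ⊆ ⊇)
  ... | yes g≈0 | no g′≉0 = contradiction g≈0 (slope≉0-transfer g′≉0 ⊇ ⊆)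
  ... | yes g≈0 | yes g′≈0 with f ≟ 0#
  ...   | yes f≈0 = 0# , trans (root-0⇒≈0 (⊆ 0# (≈0⇒root-0 f≈0))) (sym (zeroˡ f))
                     , trans g′≈0 (sym (zeroˡ g))
  ...   | no f≉0 = f′ · inv f f≉0 , sym (x·inv-y·y≈x f′ f f≉0)
                 , trans g′≈0 (sym (trans (*-congˡ g≈0) (zeroʳ _)))

  1≈x·1⇒x≈1 : ∀ {x} → 1# ≈ x · 1# → x ≈ 1#
  1≈x·1⇒x≈1 1≈x·1 = trans (sym (*-identityʳ _)) (sym 1≈x·1)

module _ {c ℓ : Level} (F : FiniteField c ℓ) where
  open FiniteField F renaming (_*_ to _·_)
  open FiniteFieldProperties F
  open W F
  open IncidenceParity F using (walk-parity)
  open import Algebra.Properties.Ring ring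
    using (-‿injective; -‿distribʳ-*; -0#≈0#; +-inverseˡ-unique; x≈y⇒x∙y⁻¹≈ε)
  open CommutativeRingSolver commRing using (Polynomial; solve; _:=_; _:+_; _:*_; _:-_; :-_; con)
  open import Relation.Binary.Reasoning.Setoid setoid

  -- The symplectic form

  infix 4 _≈ᵥ_
  _≈ᵥ_ : Vec4 → Vec4 → Set ℓ
  u ≈ᵥ v = ∀ i → u i ≈ v i

  infixr 7 _*ᵥ_
  _*ᵥ_ : Carrier → Vec4 → Vec4
  (a *ᵥ u) i = a · u i

  infixl 6 _+ᵥ_
  _+ᵥ_ : Vec4 → Vec4 → Vec4
  (u +ᵥ v) i = u i + v i

  entrywise : ∀ {p} {P : Fin 4 → Set p} → P c0 → P c1 → P c2 → P c3 → ∀ i → P i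
  entrywise p₀ p₁ p₂ p₃ fz                = p₀
  entrywise p₀ p₁ p₂ p₃ (fs fz)           = p₁
  entrywise p₀ p₁ p₂ p₃ (fs (fs fz))      = p₂
  entrywise p₀ p₁ p₂ p₃ (fs (fs (fs fz))) = p₃

  -- β on solver expressions: it evaluates definitionally to β, so solver goals can be stated with it.
  βᴾ : ∀ {n} → (Fin 4 → Polynomial n) → (Fin 4 → Polynomial n) → Polynomial n
  βᴾ x y = ((x c0 :* y c1) :- (x c1 :* y c0)) :+ ((x c2 :* y c3) :- (x c3 :* y c2))

  0ᴾ 1ᴾ : ∀ {n} → Polynomial n
  0ᴾ = con (0 , 0)
  1ᴾ = con (1 , 0)

  β-cong : ∀ {u u′ v v′} → u ≈ᵥ u′ → v ≈ᵥ v′ → β u v ≈ β u′ v′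
  β-cong u≈u′ v≈v′ =
    +-cong (+-cong (*-cong (u≈u′ c0) (v≈v′ c1)) (-‿cong (*-cong (u≈u′ c1) (v≈v′ c0))))
           (+-cong (*-cong (u≈u′ c2) (v≈v′ c3)) (-‿cong (*-cong (u≈u′ c3) (v≈v′ c2))))

  β-congʳ : ∀ u {v v′} → v ≈ᵥ v′ → β u v ≈ β u v′
  β-congʳ u = β-cong {u} (λ _ → refl)

  β-alternating : ∀ u → β u u ≈ 0#
  β-alternating u = solve 4 (λ u₀ u₁ u₂ u₃ →
      let x = u₀ ∷ u₁ ∷ u₂ ∷ u₃ ∷ [] in βᴾ x x := 0ᴾ)
    refl (u c0) (u c1) (u c2) (u c3)

  β-antisymmetric : ∀ u v → β u v ≈ - β v u
  β-antisymmetric u v = solve 8 (λ u₀ u₁ u₂ u₃ v₀ v₁ v₂ v₃ →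
      let x = u₀ ∷ u₁ ∷ u₂ ∷ u₃ ∷ []; y = v₀ ∷ v₁ ∷ v₂ ∷ v₃ ∷ [] in βᴾ x y := :- βᴾ y x)
    refl (u c0) (u c1) (u c2) (u c3) (v c0) (v c1) (v c2) (v c3)

  β-*ᵥʳ : ∀ a u v → β u (a *ᵥ v) ≈ a · β u v
  β-*ᵥʳ a u v = solve 9 (λ a u₀ u₁ u₂ u₃ v₀ v₁ v₂ v₃ →
      let x = u₀ ∷ u₁ ∷ u₂ ∷ u₃ ∷ []; y = v₀ ∷ v₁ ∷ v₂ ∷ v₃ ∷ []
      in βᴾ x (λ i → a :* y i) := a :* βᴾ x y)
    refl a (u c0) (u c1) (u c2) (u c3) (v c0) (v c1) (v c2) (v c3)

  β-span : ∀ a b d e u v → β (a *ᵥ u +ᵥ b *ᵥ v) (d *ᵥ u +ᵥ e *ᵥ v) ≈ (a · e - b · d) · β u v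
  β-span a b d e u v = solve 12 (λ a b d e u₀ u₁ u₂ u₃ v₀ v₁ v₂ v₃ →
      let x = u₀ ∷ u₁ ∷ u₂ ∷ u₃ ∷ []; y = v₀ ∷ v₁ ∷ v₂ ∷ v₃ ∷ []
      in βᴾ (λ i → a :* x i :+ b :* y i) (λ i → d :* x i :+ e :* y i) := (a :* e :- b :* d) :* βᴾ x y)
    refl a b d e (u c0) (u c1) (u c2) (u c3) (v c0) (v c1) (v c2) (v c3)

  infix 4 _⟂_
  _⟂_ : Point → Point → Set ℓ
  P ⟂ X = β (vec P) (vec X) ≈ 0#

  ⟂-sym : ∀ {P X} → P ⟂ X → X ⟂ P
  ⟂-sym {P} {X} P⟂X = begin
    β (vec X) (vec P)       ≈⟨ β-antisymmetric (vec X) (vec P) ⟩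
    - β (vec P) (vec X)     ≈⟨ -‿cong P⟂X ⟩
    - 0#                    ≈⟨ -0#≈0# ⟩
    0#                      ∎

  ⟂-respʳ-∼ : ∀ {P X Y} → X ∼ Y → P ⟂ Y → P ⟂ X
  ⟂-respʳ-∼ {P} {X} {Y} (a , x≈ay) P⟂Y = begin
    β (vec P) (vec X)          ≈⟨ β-congʳ (vec P) x≈ay ⟩
    β (vec P) (a *ᵥ vec Y)     ≈⟨ β-*ᵥʳ a (vec P) (vec Y) ⟩
    a · β (vec P) (vec Y)      ≈⟨ *-congˡ P⟂Y ⟩
    a · 0#                     ≈⟨ zeroʳ a ⟩
    0#                         ∎

  ⟂-respˡ-∼ : ∀ {P R X} → P ∼ R → R ⟂ X → P ⟂ X
  ⟂-respˡ-∼ {P} {R} {X} P∼R R⟂X =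
    ⟂-sym {X} {P} (⟂-respʳ-∼ {X} {P} {R} P∼R (⟂-sym {R} {X} R⟂X))

  ∼⇒⟂ : ∀ {P X} → P ∼ X → P ⟂ X
  ∼⇒⟂ {P} {X} P∼X = ⟂-respˡ-∼ {P} {X} {X} P∼X (β-alternating (vec X))

  ∼-refl : ∀ {P} → P ∼ P
  ∼-refl = 1# , λ _ → sym (*-identityˡ _)

  incident-A : ∀ L → Incident (A L) L
  incident-A L = 1# , 0# , λ i → solve 2 (λ a b → a := 1ᴾ :* a :+ 0ᴾ :* b)
    refl (vec (A L) i) (vec (B L) i)

  incident-B : ∀ L → Incident (B L) L
  incident-B L = 0# , 1# , λ i → solve 2 (λ a b → b := 0ᴾ :* a :+ 1ᴾ :* b)
    refl (vec (A L) i) (vec (B L) i)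

  ≋-refl : ∀ {L} → L ≋ L
  ≋-refl {L} = incident-A L , incident-B L

  incident⇒⟂ : ∀ {P X L} → Incident P L → Incident X L → P ⟂ X
  incident⇒⟂ {P} {X} {L} (a , b , p≈) (d , e , x≈) = begin
    β (vec P) (vec X)                             ≈⟨ β-cong p≈ x≈ ⟩
    β (a *ᵥ u +ᵥ b *ᵥ v) (d *ᵥ u +ᵥ e *ᵥ v)       ≈⟨ β-span a b d e u v ⟩
    (a · e - b · d) · β u v                       ≈⟨ *-congˡ (isotropic L) ⟩
    (a · e - b · d) · 0#                          ≈⟨ zeroʳ _ ⟩
    0#                                            ∎
    where
    u v : Vec4
    u = vec (A L)
    v = vec (B L)

  incident-resp-∼ : ∀ {P R L} → P ∼ R → Incident R L → Incident P L
  incident-resp-∼ {P} {R} {L} (k , p≈kr) (a , b , r≈) = k · a , k · b , λ i → begin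
    vec P i                              ≈⟨ p≈kr i ⟩
    k · vec R i                          ≈⟨ *-congˡ (r≈ i) ⟩
    k · (a · vec (A L) i + b · vec (B L) i)
      ≈⟨ solve 5 (λ k a b x y → k :* (a :* x :+ b :* y) := k :* a :* x :+ k :* b :* y)
           refl k a b (vec (A L) i) (vec (B L) i) ⟩
    k · a · vec (A L) i + k · b · vec (B L) i ∎

  _∼?_ : ∀ P X → Dec (P ∼ X)
  P ∼? X = ∃? (λ a → all? (λ i → vec P i ≟ (a · vec X i)))
              (λ a≈b p≈ax i → trans (p≈ax i) (*-congʳ a≈b))

  scalar≉0 : ∀ {P X} ((a , _) : P ∼ X) → a ≉ 0#
  scalar≉0 {P} {X} (a , p≈ax) a≈0 = proj₂ P λ i → begin
    vec P i                 ≈⟨ p≈ax i ⟩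
    a · vec X i             ≈⟨ *-congʳ a≈0 ⟩
    0# · vec X i            ≈⟨ zeroˡ _ ⟩
    0#                      ∎

  ∼-sym : ∀ {P X} → P ∼ X → X ∼ P
  ∼-sym {P} {X} P∼X@(a , p≈ax) = inv a a≉0 , λ i → sym (x≈y·z⇒inv·x≈z a≉0 (p≈ax i))
    where
    a≉0 : a ≉ 0#
    a≉0 = scalar≉0 {P} {X} P∼X

  span-independent : ∀ L {x y} → (∀ i → x · vec (A L) i + y · vec (B L) i ≈ 0#) → x ≈ 0# × y ≈ 0#
  span-independent L {x} {y} x·a+y·b≈0 with x ≟ 0#
  ... | no x≉0 = contradiction (- (inv x x≉0 · y) , a≈) (A≁B L)
    where
    a≈ : ∀ i → vec (A L) i ≈ - (inv x x≉0 · y) · vec (B L) i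
    a≈ i = begin
      vec (A L) i                       ≈⟨ x≈y·z⇒inv·x≈z x≉0 (sym (+-inverseˡ-unique _ _ (x·a+y·b≈0 i))) ⟨
      inv x x≉0 · - (y · vec (B L) i)
        ≈⟨ solve 3 (λ u y b → u :* (:- (y :* b)) := (:- (u :* y)) :* b) refl (inv x x≉0) y (vec (B L) i) ⟩
      - (inv x x≉0 · y) · vec (B L) i   ∎
  ... | yes x≈0 = x≈0 , decidable-stable (y ≟ 0#) λ y≉0 →
    proj₂ (B L) λ i → x·y≈0⇒y≈0 (y·b≈0 i) y≉0
    where
    y·b≈0 : ∀ i → y · vec (B L) i ≈ 0#
    y·b≈0 i = begin
      y · vec (B L) i                          ≈⟨ +-identityˡ _ ⟨
      0# + y · vec (B L) i                     ≈⟨ +-congʳ (trans (*-congʳ x≈0) (zeroˡ _)) ⟨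
      x · vec (A L) i + y · vec (B L) i        ≈⟨ x·a+y·b≈0 i ⟩
      0#                                       ∎

  -- Distances in the incidence graph

  walk-via : ∀ {P X} L {z n} → Incident P L → Incident X L → Walk (inj₁ X) z n →
             Walk (inj₁ P) z (suc (suc n))
  walk-via L P∈L X∈L w = step {y = inj₂ L} P∈L (step X∈L w)

  dist-collinear : ∀ {P X} → P ⟂ X → ¬ P ∼ X → Dist (inj₁ P) (inj₁ X) 2
  dist-collinear {P} {X} P⟂X P≁X =
    walk-via {P} {X} L (incident-A L) (incident-B L) (here (∼-refl {X})) , shorter
    where
    L : Line
    L = line P X P≁X P⟂X
    shorter : ∀ m → m < 2 → ¬ Walk (inj₁ P) (inj₁ X) m
    shorter 0 _ (here P∼X) = P≁X P∼X
    shorter 1 _ w with walk-parity w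
    ... | ()
    shorter (suc (suc _)) (s≤s (s≤s ()))

  dist-⟂ : ∀ {P X} → P ⟂ X → ∃ λ n → Dist (inj₁ P) (inj₁ X) n × n ≢ 4
  dist-⟂ {P} {X} P⟂X with P ∼? X
  ... | yes P∼X = 0 , (here P∼X , λ _ ()) , λ ()
  ... | no P≁X  = 2 , dist-collinear P⟂X P≁X , λ ()

  -- β(u,v)·e corrected along u and v so as to be orthogonal to both.
  ⊥-part : Vec4 → Vec4 → Vec4 → Vec4
  ⊥-part u v e = β u v *ᵥ e +ᵥ β v e *ᵥ u +ᵥ (- β u e) *ᵥ v

  β-⊥-partˡ : ∀ u v e → β u (⊥-part u v e) ≈ 0#
  β-⊥-partˡ u v e = solve 12 (λ u₀ u₁ u₂ u₃ v₀ v₁ v₂ v₃ e₀ e₁ e₂ e₃ →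
      let x = u₀ ∷ u₁ ∷ u₂ ∷ u₃ ∷ []; y = v₀ ∷ v₁ ∷ v₂ ∷ v₃ ∷ []; z = e₀ ∷ e₁ ∷ e₂ ∷ e₃ ∷ []
      in βᴾ x (λ i → βᴾ x y :* z i :+ βᴾ y z :* x i :+ (:- βᴾ x z) :* y i) := 0ᴾ)
    refl (u c0) (u c1) (u c2) (u c3) (v c0) (v c1) (v c2) (v c3) (e c0) (e c1) (e c2) (e c3)

  β-⊥-partʳ : ∀ u v e → β v (⊥-part u v e) ≈ 0#
  β-⊥-partʳ u v e = solve 12 (λ u₀ u₁ u₂ u₃ v₀ v₁ v₂ v₃ e₀ e₁ e₂ e₃ →
      let x = u₀ ∷ u₁ ∷ u₂ ∷ u₃ ∷ []; y = v₀ ∷ v₁ ∷ v₂ ∷ v₃ ∷ []; z = e₀ ∷ e₁ ∷ e₂ ∷ e₃ ∷ []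
      in βᴾ y (λ i → βᴾ x y :* z i :+ βᴾ y z :* x i :+ (:- βᴾ x z) :* y i) := 0ᴾ)
    refl (u c0) (u c1) (u c2) (u c3) (v c0) (v c1) (v c2) (v c3) (e c0) (e c1) (e c2) (e c3)

  e₀ e₂ : Vec4
  e₀ = 1# ∷ 0# ∷ 0# ∷ 0# ∷ []
  e₂ = 0# ∷ 0# ∷ 1# ∷ 0# ∷ []

  ⊥-part-e₀+⊥-part-e₂ : ∀ u v → ⊥-part u v e₀ c0 + ⊥-part u v e₂ c2 ≈ β u v
  ⊥-part-e₀+⊥-part-e₂ u v = solve 8 (λ u₀ u₁ u₂ u₃ v₀ v₁ v₂ v₃ →
      let x = u₀ ∷ u₁ ∷ u₂ ∷ u₃ ∷ []; y = v₀ ∷ v₁ ∷ v₂ ∷ v₃ ∷ []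
          z₀ = 1ᴾ ∷ 0ᴾ ∷ 0ᴾ ∷ 0ᴾ ∷ []; z₂ = 0ᴾ ∷ 0ᴾ ∷ 1ᴾ ∷ 0ᴾ ∷ []
          part = λ z i → βᴾ x y :* z i :+ βᴾ y z :* x i :+ (:- βᴾ x z) :* y i
      in part z₀ c0 :+ part z₂ c2 := βᴾ x y)
    refl (u c0) (u c1) (u c2) (u c3) (v c0) (v c1) (v c2) (v c3)

  common-neighbour : ∀ {P X} → ¬ P ⟂ X → Σ Point λ R → P ⟂ R × X ⟂ R
  common-neighbour {P} {X} P⟂̸X
    with ⊥-part (vec P) (vec X) e₀ c0 ≟ 0# | ⊥-part (vec P) (vec X) e₂ c2 ≟ 0#
  ... | no r₀≉0 | _ = (⊥-part (vec P) (vec X) e₀ , λ r≈0 → r₀≉0 (r≈0 c0)) ,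
                      β-⊥-partˡ (vec P) (vec X) e₀ , β-⊥-partʳ (vec P) (vec X) e₀
  ... | yes _ | no r₂≉0 = (⊥-part (vec P) (vec X) e₂ , λ r≈0 → r₂≉0 (r≈0 c2)) ,
                          β-⊥-partˡ (vec P) (vec X) e₂ , β-⊥-partʳ (vec P) (vec X) e₂
  ... | yes r₀≈0 | yes r₂≈0 = contradiction (begin
        β (vec P) (vec X)                                        ≈⟨ ⊥-part-e₀+⊥-part-e₂ (vec P) (vec X) ⟨
        ⊥-part (vec P) (vec X) e₀ c0 + ⊥-part (vec P) (vec X) e₂ c2  ≈⟨ +-cong r₀≈0 r₂≈0 ⟩
        0# + 0#                                                  ≈⟨ +-identityʳ 0# ⟩
        0#                                                       ∎) P⟂̸X

  dist-non⟂-via : ∀ {P X R} → ¬ P ⟂ X → P ⟂ R → X ⟂ R → Dist (inj₁ P) (inj₁ X) 4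
  dist-non⟂-via {P} {X} {R} P⟂̸X P⟂R X⟂R =
    walk-via {P} {R} L₁ (incident-A L₁) (incident-B L₁)
      (walk-via {R} {X} L₂ (incident-B L₂) (incident-A L₂) (here (∼-refl {X}))) , shorter
    where
    L₁ L₂ : Line
    L₁ = line P R (λ P∼R → P⟂̸X (⟂-respˡ-∼ {P} {R} {X} P∼R (⟂-sym {X} {R} X⟂R))) P⟂R
    L₂ = line X R (λ X∼R → P⟂̸X (⟂-respʳ-∼ {P} {X} {R} X∼R P⟂R)) X⟂R
    shorter : ∀ m → m < 4 → ¬ Walk (inj₁ P) (inj₁ X) m
    shorter 0 _ (here P∼X) = P⟂̸X (∼⇒⟂ {P} {X} P∼X)
    shorter 1 _ w with walk-parity w
    ... | ()
    shorter 2 _ (step {y = inj₂ L} P∈L (step {y = inj₁ Y} Y∈L (here Y∼X))) =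
      P⟂̸X (⟂-respʳ-∼ {P} {X} {Y} (∼-sym {Y} {X} Y∼X) (incident⇒⟂ {P} {Y} {L} P∈L Y∈L))
    shorter 3 _ w with walk-parity w
    ... | ()
    shorter (suc (suc (suc (suc _)))) (s≤s (s≤s (s≤s (s≤s ()))))

  dist-non⟂ : ∀ {P X} → ¬ P ⟂ X → Dist (inj₁ P) (inj₁ X) 4
  dist-non⟂ {P} {X} P⟂̸X =
    let R , P⟂R , X⟂R = common-neighbour {P} {X} P⟂̸X in dist-non⟂-via {P} {X} {R} P⟂̸X P⟂R X⟂R

  dist-incident : ∀ {P} L → Incident P L → Dist (inj₁ P) (inj₂ L) 1
  dist-incident {P} L P∈L = step {y = inj₂ L} P∈L (here (≋-refl {L})) , shorter
    where
    shorter : ∀ m → m < 1 → ¬ Walk (inj₁ P) (inj₂ L) m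
    shorter 0 _ w with walk-parity w
    ... | ()
    shorter (suc _) (s≤s ())

  -- L^⊥ = L. This holds for every line of W(q), but is only needed, and checked, for the lines T s.
  PerpClosed : Line → Set (c ⊔ ℓ)
  PerpClosed L = ∀ P → P ⟂ A L → P ⟂ B L → Incident P L

  projection : ∀ {P} L → PerpClosed L → ¬ Incident P L → Σ Point λ R → Incident R L × P ⟂ R
  projection {P} L closed P∉L = (r , r≉0) , (bB , - bA , λ _ → refl) , P⟂r
    where
    bA bB : Carrier
    bA = β (vec P) (vec (A L))
    bB = β (vec P) (vec (B L))
    r : Vec4
    r = bB *ᵥ vec (A L) +ᵥ (- bA) *ᵥ vec (B L)
    r≉0 : NonZero r
    r≉0 r≈0 = let bB≈0 , -bA≈0 = span-independent L r≈0
              in P∉L (closed P (-x≈0⇒x≈0 -bA≈0) bB≈0)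
    P⟂r : β (vec P) r ≈ 0#
    P⟂r = solve 12 (λ p₀ p₁ p₂ p₃ a₀ a₁ a₂ a₃ b₀ b₁ b₂ b₃ →
        let x = p₀ ∷ p₁ ∷ p₂ ∷ p₃ ∷ []; y = a₀ ∷ a₁ ∷ a₂ ∷ a₃ ∷ []; z = b₀ ∷ b₁ ∷ b₂ ∷ b₃ ∷ []
        in βᴾ x (λ i → βᴾ x z :* y i :+ (:- βᴾ x y) :* z i) := 0ᴾ)
      refl (vec P c0) (vec P c1) (vec P c2) (vec P c3) (vec (A L) c0) (vec (A L) c1) (vec (A L) c2)
           (vec (A L) c3) (vec (B L) c0) (vec (B L) c1) (vec (B L) c2) (vec (B L) c3)

  dist-nonincident-via : ∀ {P R} L → PerpClosed L → ¬ Incident P L → Incident R L → P ⟂ R →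
                         Dist (inj₁ P) (inj₂ L) 3
  dist-nonincident-via {P} {R} L closed P∉L R∈L P⟂R =
    walk-via {P} {R} L′ (incident-A L′) (incident-B L′) (step {y = inj₂ L} R∈L (here (≋-refl {L}))) , shorter
    where
    L′ : Line
    L′ = line P R (λ P∼R → P∉L (incident-resp-∼ {P} {R} {L} P∼R R∈L)) P⟂R
    shorter : ∀ m → m < 3 → ¬ Walk (inj₁ P) (inj₂ L) m
    shorter 0 _ w with walk-parity w
    ... | ()
    shorter 1 _ (step {y = inj₂ M} P∈M (here (A∈M , B∈M))) =
      P∉L (closed P (incident⇒⟂ {P} {A L} {M} P∈M A∈M) (incident⇒⟂ {P} {B L} {M} P∈M B∈M))
    shorter 2 _ w with walk-parity w
    ... | ()
    shorter (suc (suc (suc _))) (s≤s (s≤s (s≤s ())))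

  dist-nonincident : ∀ {P} L → PerpClosed L → ¬ Incident P L → Dist (inj₁ P) (inj₂ L) 3
  dist-nonincident {P} L closed P∉L =
    let R , R∈L , P⟂R = projection {P} L closed P∉L in dist-nonincident-via {P} {R} L closed P∉L R∈L P⟂R

  -- Separating points by point families and by lines

  Separates : Vertex → Point → Point → Set (c ⊔ ℓ)
  Separates x P P′ = ∃₂ λ m n → Dist (inj₁ P) x m × Dist (inj₁ P′) x n × m ≢ n

  SeparatedIn : List Vertex → Point → Point → Set (c ⊔ ℓ)
  SeparatedIn S P P′ = ∃ λ x → x ∈ S × Separates x P P′

  separates-sym : ∀ {x P P′} → Separates x P P′ → Separates x P′ P
  separates-sym (m , n , dm , dn , m≢n) = n , m , dn , dm , λ n≡m → m≢n (≡.sym n≡m)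

  ⟂-separates : ∀ {P P′ X} → P ⟂ X → ¬ P′ ⟂ X → Separates (inj₁ X) P P′
  ⟂-separates {P} {P′} {X} P⟂X P′⟂̸X =
    let n , dn , n≢4 = dist-⟂ {P} {X} P⟂X in n , 4 , dn , dist-non⟂ {P′} {X} P′⟂̸X , n≢4

  incident-separates : ∀ {P P′} L → PerpClosed L → Incident P L → ¬ Incident P′ L →
                       Separates (inj₂ L) P P′
  incident-separates L closed P∈L P′∉L =
    1 , 3 , dist-incident L P∈L , dist-nonincident L closed P′∉L , λ ()

  record PointFamily : Set (c ⊔ ℓ) where
    field
      point   : Carrier → Point
      offset  : Vec4 → Carrier
      slope   : Vec4 → Carrier
      β-point : ∀ u t → β u (vec (point t)) ≈ t · slope u - offset u

  module _ (S : List Vertex) (𝒳 : PointFamily)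
           (𝒳⊆S : ∀ {t} → t ∈ elements → inj₁ (PointFamily.point 𝒳 t) ∈ S) where
    open PointFamily 𝒳

    RootOf : Point → Carrier → Set ℓ
    RootOf P = Root (offset (vec P)) (slope (vec P))

    ⟂⇒root : ∀ {P} t → P ⟂ point t → RootOf P t
    ⟂⇒root {P} t P⟂X = sym (x-y≈0⇒x≈y (trans (sym (β-point (vec P) t)) P⟂X))

    root⇒⟂ : ∀ {P} t → RootOf P t → P ⟂ point t
    root⇒⟂ {P} t root = trans (β-point (vec P) t) (x≈y⇒x∙y⁻¹≈ε (sym root))

    separated-or-roots⊆ : ∀ P P′ → SeparatedIn S P P′ ⊎ (∀ t → RootOf P t → RootOf P′ t)
    separated-or-roots⊆ P P′
      with ⊆-or-counterexample (root? _ _) (root? _ _) (root-resp _ _) (root-resp _ _)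
    ... | inj₁ roots⊆ = inj₂ roots⊆
    ... | inj₂ (t , t∈ , root , ¬root′) =
      inj₁ (inj₁ (point t) , 𝒳⊆S t∈ ,
            ⟂-separates {P} {P′} {point t} (root⇒⟂ {P} t root) (λ P′⟂X → ¬root′ (⟂⇒root {P′} t P′⟂X)))

    separated-or-multiple : ∀ P P′ → SeparatedIn S P P′ ⊎
      Multiple (offset (vec P)) (slope (vec P)) (offset (vec P′)) (slope (vec P′))
    separated-or-multiple P P′ with separated-or-roots⊆ P P′ | separated-or-roots⊆ P′ P
    ... | inj₁ sep    | _                   = inj₁ sep
    ... | _           | inj₁ (x , x∈ , sep) = inj₁ (x , x∈ , separates-sym {x} {P′} {P} sep)
    ... | inj₂ roots⊆ | inj₂ roots⊇         = inj₂ (sameRoots⇒multiple roots⊆ roots⊇)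

  T : Carrier → Line
  T s = line (a , λ a≈0 → 1#≉0# (a≈0 c0)) (b , λ b≈0 → 1#≉0# (b≈0 c3))
             (λ (k , a≈kb) → 1#≉0# (trans (a≈kb c0) (zeroʳ k)))
             (solve 1 (λ s → βᴾ (1ᴾ ∷ 0ᴾ ∷ s ∷ 0ᴾ ∷ []) (0ᴾ ∷ :- s ∷ 0ᴾ ∷ 1ᴾ ∷ []) := 0ᴾ) refl s)
    where
    a b : Vec4
    a = 1# ∷ 0# ∷ s ∷ 0# ∷ []
    b = 0# ∷ - s ∷ 0# ∷ 1# ∷ []

  OnT : Carrier → Vec4 → Set ℓ
  OnT s u = u c2 ≈ s · u c0 × u c1 ≈ - (s · u c3)

  onT? : ∀ u → U.Decidable (λ s → OnT s u)
  onT? u s = (u c2 ≟ (s · u c0)) ×-dec (u c1 ≟ (- (s · u c3)))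

  onT-resp : ∀ u → (λ s → OnT s u) Respects _≈_
  onT-resp u s≈t (u₂≈ , u₁≈) = trans u₂≈ (*-congʳ s≈t) , trans u₁≈ (-‿cong (*-congʳ s≈t))

  onT⇒incident : ∀ P s → OnT s (vec P) → Incident P (T s)
  onT⇒incident P s (u₂≈ , u₁≈) = u c0 , u c3 , entrywise
    (solve 2 (λ x₀ x₃ → x₀ := x₀ :* 1ᴾ :+ x₃ :* 0ᴾ) refl (u c0) (u c3))
    (trans u₁≈ (solve 3 (λ s x₀ x₃ → :- (s :* x₃) := x₀ :* 0ᴾ :+ x₃ :* (:- s)) refl s (u c0) (u c3)))
    (trans u₂≈ (solve 3 (λ s x₀ x₃ → s :* x₀ := x₀ :* s :+ x₃ :* 0ᴾ) refl s (u c0) (u c3)))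
    (solve 2 (λ x₀ x₃ → x₃ := x₀ :* 0ᴾ :+ x₃ :* 1ᴾ) refl (u c0) (u c3))
    where
    u : Vec4
    u = vec P

  incident⇒onT : ∀ P s → Incident P (T s) → OnT s (vec P)
  incident⇒onT P s (α , γ , u≈) =
    trans (u≈ c2) (trans (solve 3 (λ α γ s → α :* s :+ γ :* 0ᴾ
                                           := s :* (α :* 1ᴾ :+ γ :* 0ᴾ)) refl α γ s)
                         (*-congˡ (sym (u≈ c0)))) ,
    trans (u≈ c1) (trans (solve 3 (λ α γ s → α :* 0ᴾ :+ γ :* (:- s)
                                           := :- (s :* (α :* 0ᴾ :+ γ :* 1ᴾ))) refl α γ s)
                         (-‿cong (*-congˡ (sym (u≈ c3)))))

  T-perpClosed : ∀ s → PerpClosed (T s)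
  T-perpClosed s P P⟂a P⟂b = onT⇒incident P s (u₂≈ , u₁≈)
    where
    u : Vec4
    u = vec P
    u₂≈ : u c2 ≈ s · u c0
    u₂≈ = x-y≈0⇒x≈y (trans (solve 5 (λ u₀ u₁ u₂ u₃ s →
            u₂ :- s :* u₀ := βᴾ (u₀ ∷ u₁ ∷ u₂ ∷ u₃ ∷ []) (0ᴾ ∷ :- s ∷ 0ᴾ ∷ 1ᴾ ∷ [])) refl
            (u c0) (u c1) (u c2) (u c3) s) P⟂b)
    u₁≈ : u c1 ≈ - (s · u c3)
    u₁≈ = +-inverseˡ-unique _ _ (trans (solve 5 (λ u₀ u₁ u₂ u₃ s →
            u₁ :+ s :* u₃ := :- βᴾ (u₀ ∷ u₁ ∷ u₂ ∷ u₃ ∷ []) (1ᴾ ∷ 0ᴾ ∷ s ∷ 0ᴾ ∷ [])) refl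
            (u c0) (u c1) (u c2) (u c3) s) (trans (-‿cong P⟂a) -0#≈0#))

  module _ (S : List Vertex) (T⊆S : ∀ {s} → s ∈ elements → inj₂ (T s) ∈ S) where
    separated-or-onT⊆ : ∀ P P′ → SeparatedIn S P P′ ⊎ (∀ s → OnT s (vec P) → OnT s (vec P′))
    separated-or-onT⊆ P P′
      with ⊆-or-counterexample (onT? (vec P)) (onT? (vec P′)) (onT-resp (vec P)) (onT-resp (vec P′))
    ... | inj₁ onT⊆ = inj₂ onT⊆
    ... | inj₂ (s , s∈ , on , ¬on′) =
      inj₁ (inj₂ (T s) , T⊆S s∈ , incident-separates (T s) (T-perpClosed s)
                                    (onT⇒incident P s on) (λ P′∈T → ¬on′ (incident⇒onT P′ s P′∈T)))

  module Rescaling (v w : Vec4) (l₁ l₂ l₃ : Carrier) (l₁≉l₂ : l₁ ≉ l₂)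
    (w₀ : w c0 ≈ l₂ · v c0) (w₁ : w c1 ≈ l₁ · v c1) (w₂ : w c2 ≈ l₁ · v c2) (w₃ : w c3 ≈ l₂ · v c3)
    (w₁₃ : w c1 + w c3 ≈ l₃ · (v c1 + v c3)) (w₂₀ : w c2 - w c0 ≈ l₃ · (v c2 - v c0)) where

    μ ν : Carrier
    μ = l₁ - l₃
    ν = l₃ - l₂

    μv₁≈νv₃ : μ · v c1 ≈ ν · v c3
    μv₁≈νv₃ = x-y≈0⇒x≈y (begin
      μ · v c1 - ν · v c3
        ≈⟨ solve 5 (λ l₁ l₂ l₃ x₁ x₃ → (l₁ :- l₃) :* x₁ :- (l₃ :- l₂) :* x₃
                                      := (l₁ :* x₁ :+ l₂ :* x₃) :- l₃ :* (x₁ :+ x₃)) refl l₁ l₂ l₃ (v c1) (v c3) ⟩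
      (l₁ · v c1 + l₂ · v c3) - l₃ · (v c1 + v c3)
        ≈⟨ x≈y⇒x∙y⁻¹≈ε (trans (sym (+-cong w₁ w₃)) w₁₃) ⟩
      0# ∎)

    μv₂≈-νv₀ : μ · v c2 ≈ - (ν · v c0)
    μv₂≈-νv₀ = +-inverseˡ-unique _ _ (begin
      μ · v c2 + ν · v c0
        ≈⟨ solve 5 (λ l₁ l₂ l₃ x₂ x₀ → (l₁ :- l₃) :* x₂ :+ (l₃ :- l₂) :* x₀
                                      := (l₁ :* x₂ :- l₂ :* x₀) :- l₃ :* (x₂ :- x₀)) refl l₁ l₂ l₃ (v c2) (v c0) ⟩
      (l₁ · v c2 - l₂ · v c0) - l₃ · (v c2 - v c0)
        ≈⟨ x≈y⇒x∙y⁻¹≈ε (trans (sym (+-cong w₂ (-‿cong w₀))) w₂₀) ⟩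
      0# ∎)

    μ≈0⇒ν≉0 : μ ≈ 0# → ν ≉ 0#
    μ≈0⇒ν≉0 μ≈0 ν≈0 = l₁≉l₂ (x-y≈0⇒x≈y (begin
      l₁ - l₂     ≈⟨ solve 3 (λ l₁ l₂ l₃ → l₁ :- l₂ := (l₁ :- l₃) :+ (l₃ :- l₂)) refl l₁ l₂ l₃ ⟩
      μ + ν       ≈⟨ +-cong μ≈0 ν≈0 ⟩
      0# + 0#     ≈⟨ +-identityʳ 0# ⟩
      0#          ∎))

    ≈0⇒scalars-agree : ∀ {x} a b → x ≈ 0# → a · x ≈ b · x
    ≈0⇒scalars-agree a b x≈0 = trans (*-congˡ x≈0) (trans (zeroʳ a) (sym (trans (*-congˡ x≈0) (zeroʳ b))))

    μ≈0⇒w≈l₁v : μ ≈ 0# → w ≈ᵥ l₁ *ᵥ v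
    μ≈0⇒w≈l₁v μ≈0 = entrywise (trans w₀ (≈0⇒scalars-agree l₂ l₁ v₀≈0)) w₁ w₂
                              (trans w₃ (≈0⇒scalars-agree l₂ l₁ v₃≈0))
      where
      v₃≈0 : v c3 ≈ 0#
      v₃≈0 = x·y≈0⇒y≈0 (trans (sym μv₁≈νv₃) (trans (*-congʳ μ≈0) (zeroˡ _))) (μ≈0⇒ν≉0 μ≈0)
      v₀≈0 : v c0 ≈ 0#
      v₀≈0 = x·y≈0⇒y≈0 (-x≈0⇒x≈0 (trans (sym μv₂≈-νv₀) (trans (*-congʳ μ≈0) (zeroˡ _)))) (μ≈0⇒ν≉0 μ≈0)

    ν≈0⇒w≈l₂v : ν ≈ 0# → μ ≉ 0# → w ≈ᵥ l₂ *ᵥ v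
    ν≈0⇒w≈l₂v ν≈0 μ≉0 = entrywise w₀ (trans w₁ (≈0⇒scalars-agree l₁ l₂ v₁≈0))
                                     (trans w₂ (≈0⇒scalars-agree l₁ l₂ v₂≈0)) w₃
      where
      ν·x≈0 : ∀ x → ν · x ≈ 0#
      ν·x≈0 x = trans (*-congʳ ν≈0) (zeroˡ x)
      v₁≈0 : v c1 ≈ 0#
      v₁≈0 = x·y≈0⇒y≈0 (trans μv₁≈νv₃ (ν·x≈0 (v c3))) μ≉0
      v₂≈0 : v c2 ≈ 0#
      v₂≈0 = x·y≈0⇒y≈0 (trans μv₂≈-νv₀ (trans (-‿cong (ν·x≈0 (v c0))) -0#≈0#)) μ≉0

    μν≉0⇒v≈0 : μ ≉ 0# → ν ≉ 0# → (∀ s → OnT s v → OnT s w) → ∀ i → v i ≈ 0#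
    μν≉0⇒v≈0 μ≉0 ν≉0 onT⊆ = entrywise v₀≈0 v₁≈0 v₂≈0 v₃≈0
      where
      -- v lies on T s, hence so does w, and reading w both ways gives l₁ vᵢ = l₂ vᵢ for i = 1, 2.
      s : Carrier
      s = - (inv μ μ≉0 · ν)
      v₂≈sv₀ : v c2 ≈ s · v c0
      v₂≈sv₀ = trans (sym (x≈y·z⇒inv·x≈z μ≉0 (sym μv₂≈-νv₀)))
                     (solve 3 (λ i n x → i :* (:- (n :* x)) := (:- (i :* n)) :* x) refl (inv μ μ≉0) ν (v c0))
      v₁≈-sv₃ : v c1 ≈ - (s · v c3)
      v₁≈-sv₃ = trans (sym (x≈y·z⇒inv·x≈z μ≉0 (sym μv₁≈νv₃)))
                      (solve 3 (λ i n x → i :* (n :* x) := :- ((:- (i :* n)) :* x)) refl (inv μ μ≉0) ν (v c3))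
      w-onT : OnT s w
      w-onT = onT⊆ s (v₂≈sv₀ , v₁≈-sv₃)
      v₂≈0 : v c2 ≈ 0#
      v₂≈0 = x·z≈y·z⇒z≈0 (begin
        l₁ · v c2          ≈⟨ w₂ ⟨
        w c2               ≈⟨ proj₁ w-onT ⟩
        s · w c0           ≈⟨ *-congˡ w₀ ⟩
        s · (l₂ · v c0)    ≈⟨ solve 3 (λ s l x → s :* (l :* x) := l :* (s :* x)) refl s l₂ (v c0) ⟩
        l₂ · (s · v c0)    ≈⟨ *-congˡ v₂≈sv₀ ⟨
        l₂ · v c2          ∎) l₁≉l₂
      v₁≈0 : v c1 ≈ 0#
      v₁≈0 = x·z≈y·z⇒z≈0 (begin
        l₁ · v c1              ≈⟨ w₁ ⟨
        w c1                   ≈⟨ proj₂ w-onT ⟩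
        - (s · w c3)           ≈⟨ -‿cong (*-congˡ w₃) ⟩
        - (s · (l₂ · v c3))    ≈⟨ solve 3 (λ s l x → :- (s :* (l :* x)) := l :* (:- (s :* x))) refl s l₂ (v c3) ⟩
        l₂ · - (s · v c3)      ≈⟨ *-congˡ v₁≈-sv₃ ⟨
        l₂ · v c1              ∎) l₁≉l₂
      v₀≈0 : v c0 ≈ 0#
      v₀≈0 = x·y≈0⇒y≈0 (-x≈0⇒x≈0 (trans (sym μv₂≈-νv₀) (trans (*-congˡ v₂≈0) (zeroʳ μ)))) ν≉0
      v₃≈0 : v c3 ≈ 0#
      v₃≈0 = x·y≈0⇒y≈0 (trans (sym μv₁≈νv₃) (trans (*-congˡ v₁≈0) (zeroʳ μ))) ν≉0

  invariants⇒∼ : ∀ P P′ →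
    Multiple (vec P c1) (vec P c2) (vec P′ c1) (vec P′ c2) →
    Multiple (vec P c0) (vec P c3) (vec P′ c0) (vec P′ c3) →
    Multiple (vec P c1 + vec P c3) (vec P c2 - vec P c0) (vec P′ c1 + vec P′ c3) (vec P′ c2 - vec P′ c0) →
    (∀ s → OnT s (vec P) → OnT s (vec P′)) → P′ ∼ P
  invariants⇒∼ P P′ (l₁ , w₁ , w₂) (l₂ , w₀ , w₃) (l₃ , w₁₃ , w₂₀) onT⊆ with l₁ ≟ l₂
  ... | yes l₁≈l₂ = l₁ , entrywise (trans w₀ (*-congʳ (sym l₁≈l₂))) w₁ w₂ (trans w₃ (*-congʳ (sym l₁≈l₂)))
  ... | no l₁≉l₂ = distinct-scalings
    where
    open Rescaling (vec P) (vec P′) l₁ l₂ l₃ l₁≉l₂ w₀ w₁ w₂ w₃ w₁₃ w₂₀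
    distinct-scalings : P′ ∼ P
    distinct-scalings with μ ≟ 0# | ν ≟ 0#
    ... | yes μ≈0 | _       = l₁ , μ≈0⇒w≈l₁v μ≈0
    ... | no μ≉0  | yes ν≈0 = l₂ , ν≈0⇒w≈l₂v ν≈0 μ≉0
    ... | no μ≉0  | no ν≉0  = contradiction (μν≉0⇒v≈0 μ≉0 ν≉0 onT⊆) (proj₂ P)

  -- The set S

  X₁ X₂ X₃ : PointFamily
  X₁ = record
    { point   = λ t → (1# ∷ 0# ∷ 0# ∷ t ∷ []) , λ x≈0 → 1#≉0# (x≈0 c0)
    ; offset  = λ u → u c1
    ; slope   = λ u → u c2
    ; β-point = λ u t → solve 5 (λ u₀ u₁ u₂ u₃ t →
        βᴾ (u₀ ∷ u₁ ∷ u₂ ∷ u₃ ∷ []) (1ᴾ ∷ 0ᴾ ∷ 0ᴾ ∷ t ∷ []) := t :* u₂ :- u₁)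
        refl (u c0) (u c1) (u c2) (u c3) t
    }
  X₂ = record
    { point   = λ t → (0# ∷ - 1# ∷ - t ∷ 0# ∷ []) , λ x≈0 → 1#≉0# (-x≈0⇒x≈0 (x≈0 c1))
    ; offset  = λ u → u c0
    ; slope   = λ u → u c3
    ; β-point = λ u t → solve 5 (λ u₀ u₁ u₂ u₃ t →
        βᴾ (u₀ ∷ u₁ ∷ u₂ ∷ u₃ ∷ []) (0ᴾ ∷ :- 1ᴾ ∷ :- t ∷ 0ᴾ ∷ []) := t :* u₃ :- u₀)
        refl (u c0) (u c1) (u c2) (u c3) t
    }
  X₃ = record
    { point   = λ t → (1# ∷ - t ∷ 1# ∷ t ∷ []) , λ x≈0 → 1#≉0# (x≈0 c0)
    ; offset  = λ u → u c1 + u c3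
    ; slope   = λ u → u c2 - u c0
    ; β-point = λ u t → solve 5 (λ u₀ u₁ u₂ u₃ t →
        βᴾ (u₀ ∷ u₁ ∷ u₂ ∷ u₃ ∷ []) (1ᴾ ∷ :- t ∷ 1ᴾ ∷ t ∷ []) := t :* (u₂ :- u₀) :- (u₁ :+ u₃))
        refl (u c0) (u c1) (u c2) (u c3) t
    }

  family : PointFamily → Carrier → Vertex
  family 𝒳 t = inj₁ (PointFamily.point 𝒳 t)

  line-family : Carrier → Vertex
  line-family s = inj₂ (T s)

  S : List Vertex
  S = map (family X₁) elements ++ map (family X₂) elements ++ map (family X₃) elements
      ++ map line-family elements

  X₁⊆S : ∀ {t} → t ∈ elements → family X₁ t ∈ S
  X₁⊆S t∈ = ∈-++⁺ˡ (∈-map⁺ (family X₁) t∈)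

  X₂⊆S : ∀ {t} → t ∈ elements → family X₂ t ∈ S
  X₂⊆S t∈ = ∈-++⁺ʳ (map (family X₁) elements) (∈-++⁺ˡ (∈-map⁺ (family X₂) t∈))

  X₃⊆S : ∀ {t} → t ∈ elements → family X₃ t ∈ S
  X₃⊆S t∈ = ∈-++⁺ʳ (map (family X₁) elements) (∈-++⁺ʳ (map (family X₂) elements)
              (∈-++⁺ˡ (∈-map⁺ (family X₃) t∈)))

  T⊆S : ∀ {s} → s ∈ elements → line-family s ∈ S
  T⊆S s∈ = ∈-++⁺ʳ (map (family X₁) elements) (∈-++⁺ʳ (map (family X₂) elements)
             (∈-++⁺ʳ (map (family X₃) elements) (∈-map⁺ line-family s∈)))

  X₁-injective : ∀ {s t} → s ≉ t → ¬ family X₁ s ≈V family X₁ t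
  X₁-injective s≉t (k , s≈kt) =
    s≉t (trans (s≈kt c3) (trans (*-congʳ (1≈x·1⇒x≈1 (s≈kt c0))) (*-identityˡ _)))

  X₂-injective : ∀ {s t} → s ≉ t → ¬ family X₂ s ≈V family X₂ t
  X₂-injective {s} {t} s≉t (k , s≈kt) = s≉t (begin
    s                 ≈⟨ -‿injective (trans (s≈kt c2) (sym (-‿distribʳ-* k t))) ⟩
    k · t             ≈⟨ *-congʳ k≈1 ⟩
    1# · t            ≈⟨ *-identityˡ t ⟩
    t                 ∎)
    where
    k≈1 : k ≈ 1#
    k≈1 = 1≈x·1⇒x≈1 (-‿injective (trans (s≈kt c1) (sym (-‿distribʳ-* k 1#))))

  X₃-injective : ∀ {s t} → s ≉ t → ¬ family X₃ s ≈V family X₃ t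
  X₃-injective s≉t (k , s≈kt) =
    s≉t (trans (s≈kt c3) (trans (*-congʳ (1≈x·1⇒x≈1 (s≈kt c0))) (*-identityˡ _)))

  T-injective : ∀ {s t} → s ≉ t → ¬ line-family s ≈V line-family t
  T-injective {s} {t} s≉t (A[Tt]∈Ts , _) =
    s≉t (sym (trans (proj₁ (incident⇒onT (A (T t)) s A[Tt]∈Ts)) (*-identityʳ s)))

  X₁≉X₂ : ∀ s t → ¬ family X₁ s ≈V family X₂ t
  X₁≉X₂ s t (k , s≈kt) = 1#≉0# (trans (s≈kt c0) (zeroʳ k))

  X₁≉X₃ : ∀ s t → ¬ family X₁ s ≈V family X₃ t
  X₁≉X₃ s t (k , s≈kt) = 1#≉0# (sym (trans (s≈kt c2) (trans (*-identityʳ k) (1≈x·1⇒x≈1 (s≈kt c0)))))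

  X₂≉X₃ : ∀ s t → ¬ family X₂ s ≈V family X₃ t
  X₂≉X₃ s t (k , s≈kt) = 1#≉0# (-x≈0⇒x≈0 (begin
    - 1#           ≈⟨ s≈kt c1 ⟩
    k · - t        ≈⟨ *-congʳ k≈0 ⟩
    0# · - t       ≈⟨ zeroˡ _ ⟩
    0#             ∎))
    where
    k≈0 : k ≈ 0#
    k≈0 = sym (trans (s≈kt c0) (*-identityʳ k))

  point≉line : ∀ 𝒳 s t → ¬ family 𝒳 s ≈V line-family t
  point≉line _ _ _ ()

  injective⇒distinct : ∀ {f : Carrier → Vertex} → (∀ {s t} → s ≉ t → ¬ f s ≈V f t) →
                       DistinctVertices (map f elements)
  injective⇒distinct f-injective = AllPairs.map⁺ (AllPairs.map f-injective distinct)

  distinct-S : DistinctVertices S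
  distinct-S =
    AllPairs.++⁺ (injective⇒distinct X₁-injective)
      (AllPairs.++⁺ (injective⇒distinct X₂-injective)
        (AllPairs.++⁺ (injective⇒distinct X₃-injective) (injective⇒distinct T-injective)
          (All-map-elements (family X₃) λ s → All-map-elements line-family (point≉line X₃ s)))
        (All-map-elements (family X₂) λ s →
          All.++⁺ (All-map-elements (family X₃) (X₂≉X₃ s))
                  (All-map-elements line-family (point≉line X₂ s))))
      (All-map-elements (family X₁) λ s →
        All.++⁺ (All-map-elements (family X₂) (X₁≉X₂ s))
                (All.++⁺ (All-map-elements (family X₃) (X₁≉X₃ s))
                         (All-map-elements line-family (point≉line X₁ s))))

  separated-or-∼ : ∀ P P′ → SeparatedIn S P P′ ⊎ P′ ∼ P
  separated-or-∼ P P′ = do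
    m₁   ← separated-or-multiple S X₁ X₁⊆S P P′
    m₂   ← separated-or-multiple S X₂ X₂⊆S P P′
    m₃   ← separated-or-multiple S X₃ X₃⊆S P P′
    onT⊆ ← separated-or-onT⊆ S T⊆S P P′
    pure (invariants⇒∼ P P′ m₁ m₂ m₃ onT⊆)
    where open RawMonad (SumMonad.monad (SeparatedIn S P P′) 0ℓ)

  semiResolving : SemiResolving S
  semiResolving P P′ P≁P′ =
    fromInj₁ (λ P′∼P → contradiction (∼-sym {P′} {P} P′∼P) P≁P′) (separated-or-∼ P P′)

mainTheorem18 : ∀ {c ℓ : Level} (F : FiniteField c ℓ) →
    ∃ λ (S : List (W.Vertex F)) →
    length S ≡ 4 * FiniteField.q F × W.DistinctVertices F S × W.SemiResolving F S
mainTheorem18 F = S F , length-S , distinct-S F , semiResolving F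
  where
  open FiniteField F using (elements; length-elements)
  length-S : length (S F) ≡ 4 * FiniteField.q F
  length-S = ≡.trans (length-++-map₄ _ _ _ _ elements) (≡.cong (4 *_) length-elements)
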